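{- Let $a\in\{0,1\}$, $m\ge1$, and $w=\overline{a}^{j_m}a^{i_m}\cdots\overline{a}^{j_1}a^{i_1}$ with integers $i_r,j_r\ge1$ for all $r$. Then every cycle of the permutation $S_a(w)$ has length at most $\max_{r}2^{\lceil\log_2(i_r+1)\rceil}$, and every cycle of $S_{\overline{a}}(w)$ has length at most $\max\left(\{2^{\lceil\log_2 j_m\rceil}\}\cup\{2^{\lceil\log_2(j_r+1)\rceil}: r<m\}\right)$.
   Context: For words $w=w_1\cdots w_\ell$, $u=u_1\cdots u_\ell$ over $\{0,1\}$ and $a\in\{0,1\}$, $S_a(w)(u)\in\{0,1\}^\ell$ is the word with $\ell$-th letter $u_\ell$ and $i$-th letter $u_i\oplus(u_{i+1}\wedge[w_{i+1}=a])$ for $1\le i\le\ell-1$ ($[\cdot]$ the indicator; $\oplus,\wedge$ XOR/AND); $S_a(w)$ is a bijection of $\{0,1\}^\ell$, and its cycles are the orbits $\{S_a(w)^n(u):n\ge0\}$. $\overline{0}=1$, $\overline{1}=0$, and $x^k$ is $k$-fold concatenation. -}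

module Defs where

open import Data.Bool using (Bool; true; false; not; _∧_; _xor_)
open import Data.Nat using (ℕ; zero; suc; _+_; _^_; _⊔_; _≤_; _<_)
open import Data.Nat.Logarithm using (⌈log₂_⌉)
open import Data.List using (List; []; _∷_; _++_; replicate; length)
open import Data.Vec using (Vec; []; _∷_; fromList)
open import Data.Product using (_×_)
open import Relation.Binary.PropositionalEquality using (_≡_; _≢_)

bar : Bool → Bool
bar = not

eqB : Bool → Bool → Bool
eqB x a = not (x xor a)

S : ∀ {ℓ} → Bool → Vec Bool ℓ → Vec Bool ℓ → Vec Bool ℓ
S a [] [] = []
S a (w₁ ∷ []) (u₁ ∷ []) = u₁ ∷ []
S a (w₁ ∷ w₂ ∷ ws) (u₁ ∷ u₂ ∷ us) =
  (u₁ xor (u₂ ∧ eqB w₂ a)) ∷ S a (w₂ ∷ ws) (u₂ ∷ us)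

iter : ∀ {A : Set} → ℕ → (A → A) → A → A
iter zero f x = x
iter (suc n) f x = f (iter n f x)

IsCycleLength : ∀ {A : Set} → (A → A) → A → ℕ → Set
IsCycleLength f x n =
  (0 < n) × (iter n f x ≡ x) × (∀ k → 0 < k → k < n → iter k f x ≢ x)

word : Bool → (ℕ → ℕ) → (ℕ → ℕ) → ℕ → List Bool
word a i j zero = []
word a i j (suc r) =
  (replicate (j (suc r)) (bar a) ++ replicate (i (suc r)) a) ++ word a i j r

maxOver : (ℕ → ℕ) → ℕ → ℕ
maxOver f zero = 0
maxOver f (suc r) = f (suc r) ⊔ maxOver f r

pow2ceil : ℕ → ℕ
pow2ceil x = 2 ^ ⌈log₂ x ⌉

{-# OPTIONS --safe #-}
module Submission where

-- Over GF(2), S_a(w) = I + N with N the nilpotent shift weighted by c_i = [w_{i+1} = a].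
-- In characteristic 2, (I + N)^(2^K) = I + N^(2^K), and the (i, i + d) entry of N^d is
-- c_i ⋯ c_{i+d-1}, which vanishes unless w_{i+1} ⋯ w_{i+d} is a run of a's.  Hence S_a(w)^P
-- is the identity for every power of two P exceeding all runs of a in w minus its first
-- letter, and every cycle has length at most P.  Those runs are the blocks a^{i_r} for
-- S_a(w), and ā^{j_m - 1} together with ā^{j_r} (r < m) for S_ā(w); the bounds in the
-- statement are powers of two exceeding them.

open import Defs
open import Data.Bool using (Bool; true; false; not; _∧_; _xor_)
open import Data.Bool.Properties using (∧-assoc; ∧-comm; ∧-identityʳ; ∧-zeroʳ; xor-identityʳ; not-involutive; not-¬)
open import Data.Nat using (ℕ; zero; suc; _+_; _∸_; _^_; _≤_; _<_; _⊔_; z≤n; s≤s; ⌊_/2⌋; ⌈_/2⌉)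
open import Data.Nat.Properties
open import Data.Nat.Logarithm using (⌈log₂_⌉)
open import Data.Nat.Logarithm.Core using (⌈log2⌉)
open import Data.Nat.Induction using (<-wellFounded)
open import Data.List using (List; []; _∷_; _++_; replicate; length; drop)
open import Data.List.Properties using (++-assoc)
open import Data.Vec using (Vec; []; _∷_; fromList; toList)
open import Data.Vec.Properties using (toList∘fromList)
open import Data.Product using (_×_; _,_; ∃-syntax)
open import Data.Sum using (inj₁; inj₂)
open import Function using (_∘_)
open import Induction.WellFounded using (Acc; acc)
open import Relation.Nullary using (contradiction)
open import Relation.Binary.PropositionalEquality

Stream : Set
Stream = ℕ → Bool

nth : {A : Set} → A → List A → ℕ → A
nth d []       n       = d
nth d (x ∷ xs) zero    = x
nth d (x ∷ xs) (suc n) = nth d xs n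

toStream : ∀ {L} → Vec Bool L → Stream
toStream u = nth false (toList u)

toStream-injective : ∀ {L} (u v : Vec Bool L) → toStream u ≗ toStream v → u ≡ v
toStream-injective []       []       _  = refl
toStream-injective (x ∷ u) (y ∷ v) eq = cong₂ _∷_ (eq 0) (toStream-injective u v (eq ∘ suc))

-- For a weight stream c, N is the weighted shift (N v) i = c i ∧ v (i + 1) over GF(2);
-- window c i d is the (i, i + d) entry of N^d.

window : Stream → ℕ → ℕ → Bool
window c i zero    = true
window c i (suc d) = c i ∧ window c (suc i) d

I+N : Stream → Stream → Stream
I+N c v i = v i xor (c i ∧ v (suc i))

I+N^ : Stream → ℕ → Stream → Stream
I+N^ c d v i = v i xor (window c i d ∧ v (i + d))

window-+ : ∀ c i d e → window c i (d + e) ≡ window c i d ∧ window c (i + d) e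
window-+ c i zero    e = cong (λ k → window c k e) (sym (+-identityʳ i))
window-+ c i (suc d) e = begin
  c i ∧ window c (suc i) (d + e)                    ≡⟨ cong (c i ∧_) (window-+ c (suc i) d e) ⟩
  c i ∧ (window c (suc i) d ∧ window c (suc i + d) e) ≡⟨ ∧-assoc (c i) _ _ ⟨
  (c i ∧ window c (suc i) d) ∧ window c (suc i + d) e
    ≡⟨ cong (λ k → (c i ∧ window c (suc i) d) ∧ window c k e) (+-suc i d) ⟨
  (c i ∧ window c (suc i) d) ∧ window c (i + suc d) e ∎
  where open ≡-Reasoning

window-suc : ∀ c i d → window c (suc i) d ≡ window (c ∘ suc) i d
window-suc c i zero    = refl
window-suc c i (suc d) = cong (c (suc i) ∧_) (window-suc c (suc i) d)

I+N≗I+N^1 : ∀ c v → I+N c v ≗ I+N^ c 1 v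
I+N≗I+N^1 c v i = cong₂ (λ x y → v i xor (x ∧ v y)) (sym (∧-identityʳ (c i))) (+-comm 1 i)

I+N-cong : ∀ c {v w} → v ≗ w → I+N c v ≗ I+N c w
I+N-cong c eq i = cong₂ (λ x y → x xor (c i ∧ y)) (eq i) (eq (suc i))

I+N^-cong : ∀ c d {v w} → v ≗ w → I+N^ c d v ≗ I+N^ c d w
I+N^-cong c d eq i = cong₂ (λ x y → x xor (window c i d ∧ y)) (eq i) (eq (i + d))

-- The two A ∧ y terms cancel: this is where characteristic 2 is used.
xor-telescope : ∀ x A y B z → (x xor (A ∧ y)) xor (A ∧ (y xor (B ∧ z))) ≡ x xor ((A ∧ B) ∧ z)
xor-telescope false false y     B z = refl
xor-telescope true  false y     B z = refl
xor-telescope false true  false B z = refl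
xor-telescope false true  true  B z = not-involutive (B ∧ z)
xor-telescope true  true  false B z = refl
xor-telescope true  true  true  B z = refl

I+N^-square : ∀ c d v → I+N^ c d (I+N^ c d v) ≗ I+N^ c (d + d) v
I+N^-square c d v i =
  trans (xor-telescope (v i) (window c i d) (v (i + d)) (window c (i + d) d) (v (i + d + d)))
        (cong₂ (λ x k → v i xor (x ∧ v k)) (sym (window-+ c i d d)) (+-assoc i d d))

iter-+ : ∀ {A : Set} m n (f : A → A) x → iter (m + n) f x ≡ iter m f (iter n f x)
iter-+ zero    n f x = refl
iter-+ (suc m) n f x = cong f (iter-+ m n f x)

iter-I+N-2^ : ∀ c K v → iter (2 ^ K) (I+N c) v ≗ I+N^ c (2 ^ K) v
iter-I+N-2^ c zero    v = I+N≗I+N^1 c v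
iter-I+N-2^ c (suc K) v i rewrite +-identityʳ (2 ^ K) = begin
  iter (P + P) (I+N c) v i          ≡⟨ cong (λ w → w i) (iter-+ P P (I+N c) v) ⟩
  iter P (I+N c) (iter P (I+N c) v) i ≡⟨ iter-I+N-2^ c K _ i ⟩
  I+N^ c P (iter P (I+N c) v) i     ≡⟨ I+N^-cong c P (iter-I+N-2^ c K v) i ⟩
  I+N^ c P (I+N^ c P v) i           ≡⟨ I+N^-square c P v i ⟩
  I+N^ c (P + P) v i                ∎
  where
  P = 2 ^ K
  open ≡-Reasoning

I+N^-identity : ∀ c d v → (∀ i → window c i d ≡ false) → I+N^ c d v ≗ v
I+N^-identity c d v vanish i rewrite vanish i = xor-identityʳ (v i)

-- Padding with not b keeps every run of b inside the list.
letterIs : Bool → List Bool → Stream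
letterIs b l n = eqB (nth (not b) l n) b

-- The weight c i = [w_{i+1} = a] of S a w, counting positions from 0.
weights : ∀ {L} → Bool → Vec Bool L → Stream
weights a w = letterIs a (drop 1 (toList w))

S-toStream : ∀ {L} a (w u : Vec Bool L) → toStream (S a w u) ≗ I+N (weights a w) (toStream u)
S-toStream a []       []       i       = sym (∧-zeroʳ _)
S-toStream a (_ ∷ []) (u ∷ []) zero    = sym (trans (cong (u xor_) (∧-zeroʳ _)) (xor-identityʳ u))
S-toStream a (_ ∷ []) (u ∷ []) (suc i) = sym (∧-zeroʳ _)
S-toStream a (_ ∷ w₂ ∷ ws) (u₁ ∷ u₂ ∷ us) zero = cong (u₁ xor_) (∧-comm u₂ (eqB w₂ a))
S-toStream a (_ ∷ w₂ ∷ ws) (_ ∷ u₂ ∷ us) (suc i) = S-toStream a (w₂ ∷ ws) (u₂ ∷ us) i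

iter-S-toStream : ∀ {L} a (w u : Vec Bool L) k →
  toStream (iter k (S a w) u) ≗ iter k (I+N (weights a w)) (toStream u)
iter-S-toStream a w u zero    i = refl
iter-S-toStream a w u (suc k) i =
  trans (S-toStream a w (iter k (S a w) u) i) (I+N-cong (weights a w) (iter-S-toStream a w u k) i)

record RunsBelow (b : Bool) (P : ℕ) (l : List Bool) : Set where
  constructor runsBelow
  field window-false : ∀ i → window (letterIs b l) i P ≡ false

S-period : ∀ {L} a (w u : Vec Bool L) K →
  RunsBelow a (2 ^ K) (drop 1 (toList w)) → iter (2 ^ K) (S a w) u ≡ u
S-period a w u K (runsBelow short) = toStream-injective _ u λ i → begin
  toStream (iter (2 ^ K) (S a w) u) i           ≡⟨ iter-S-toStream a w u (2 ^ K) i ⟩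
  iter (2 ^ K) (I+N (weights a w)) (toStream u) i ≡⟨ iter-I+N-2^ (weights a w) K (toStream u) i ⟩
  I+N^ (weights a w) (2 ^ K) (toStream u) i     ≡⟨ I+N^-identity (weights a w) (2 ^ K) (toStream u) short i ⟩
  toStream u i                                  ∎
  where open ≡-Reasoning

cycleLength-≤ : ∀ {A : Set} {f : A → A} {x n p} →
  IsCycleLength f x n → 0 < p → iter p f x ≡ x → n ≤ p
cycleLength-≤ (_ , _ , minimal) p>0 fixed = ≮⇒≥ λ p<n → minimal _ p>0 p<n fixed

IsPowerOf2 : ℕ → Set
IsPowerOf2 P = ∃[ K ] P ≡ 2 ^ K

IsPowerOf2⇒positive : ∀ {P} → IsPowerOf2 P → 1 ≤ P
IsPowerOf2⇒positive (K , refl) = m^n>0 2 K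

S-fromList-cycleLength-≤ : ∀ a l P → IsPowerOf2 P → RunsBelow a P (drop 1 l) →
  ∀ u n → IsCycleLength (S a (fromList l)) u n → n ≤ P
S-fromList-cycleLength-≤ a l P (K , refl) short u n cycle =
  cycleLength-≤ cycle (IsPowerOf2⇒positive (K , refl))
    (S-period a (fromList l) u K (subst (RunsBelow a (2 ^ K) ∘ drop 1) (sym (toList∘fromList l)) short))

eqB-refl : ∀ b → eqB b b ≡ true
eqB-refl true  = refl
eqB-refl false = refl

eqB-≢ : ∀ {x b} → x ≢ b → eqB x b ≡ false
eqB-≢ {true}  {true}  x≢b = contradiction refl x≢b
eqB-≢ {true}  {false} _   = refl
eqB-≢ {false} {true}  _   = refl
eqB-≢ {false} {false} x≢b = contradiction refl x≢b

not-≢ : ∀ b → not b ≢ b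
not-≢ true  ()
not-≢ false ()

letterIs-replicate : ∀ {n} b x l → 1 ≤ n → letterIs b (replicate n x ++ l) 0 ≡ eqB x b
letterIs-replicate b x l (s≤s _) = refl

false-∧ : ∀ {x y} → x ≡ false → x ∧ y ≡ false
false-∧ refl = refl

RunsBelow-[] : ∀ {b P} → 1 ≤ P → RunsBelow b P []
RunsBelow-[] {b} (s≤s _) = runsBelow λ i → false-∧ (eqB-≢ (not-≢ b))

RunsBelow-tail : ∀ {b P x l} → RunsBelow b P (x ∷ l) → RunsBelow b P l
RunsBelow-tail {b} {P} {x} (runsBelow short) =
  runsBelow λ i → trans (sym (window-suc (letterIs b (x ∷ _)) i P)) (short (suc i))

RunsBelow-drop1 : ∀ {b P} l → RunsBelow b P l → RunsBelow b P (drop 1 l)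
RunsBelow-drop1 []      short = short
RunsBelow-drop1 (_ ∷ _) short = RunsBelow-tail short

RunsBelow-∷ : ∀ {b P x l} → 1 ≤ P → x ≢ b → RunsBelow b P l → RunsBelow b P (x ∷ l)
RunsBelow-∷ {b} {P} {x} {l} (s≤s _) x≢b (runsBelow short) = runsBelow λ where
  zero    → false-∧ (eqB-≢ x≢b)
  (suc i) → trans (window-suc (letterIs b (x ∷ l)) i P) (short i)

RunsBelow-replicate-≢ : ∀ {b P x l} n → 1 ≤ P → x ≢ b → RunsBelow b P l →
  RunsBelow b P (replicate n x ++ l)
RunsBelow-replicate-≢ zero    _   _   short = short
RunsBelow-replicate-≢ (suc n) P≥1 x≢b short = RunsBelow-∷ P≥1 x≢b (RunsBelow-replicate-≢ n P≥1 x≢b short)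

window-replicate : ∀ b l {n d} → n < d → letterIs b l 0 ≡ false →
  window (letterIs b (replicate n b ++ l)) 0 d ≡ false
window-replicate b l {zero}  (s≤s _) l₀≢b = false-∧ l₀≢b
window-replicate b l {suc n} {suc d} (s≤s n<d) l₀≢b = begin
  eqB b b ∧ window (letterIs b (b ∷ replicate n b ++ l)) 1 d ≡⟨ cong (_∧ window (letterIs b (b ∷ replicate n b ++ l)) 1 d) (eqB-refl b) ⟩
  window (letterIs b (b ∷ replicate n b ++ l)) 1 d           ≡⟨ window-suc (letterIs b (b ∷ replicate n b ++ l)) 0 d ⟩
  window (letterIs b (replicate n b ++ l)) 0 d               ≡⟨ window-replicate b l n<d l₀≢b ⟩
  false                                                      ∎
  where open ≡-Reasoning

-- The hypothesis on l makes replicate n b a maximal run.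
RunsBelow-replicate : ∀ {b P l} n → n < P → letterIs b l 0 ≡ false → RunsBelow b P l →
  RunsBelow b P (replicate n b ++ l)
RunsBelow-replicate zero _ _ short = short
RunsBelow-replicate {b} {P} {l} (suc n) n<P l₀≢b short = runsBelow λ where
  zero    → window-replicate b l n<P l₀≢b
  (suc i) → trans (window-suc (letterIs b (b ∷ replicate n b ++ l)) i P)
                  (RunsBelow.window-false (RunsBelow-replicate n (<⇒≤ n<P) l₀≢b short) i)

ForAll1To : ℕ → (ℕ → Set) → Set
ForAll1To r p = ∀ s → 1 ≤ s → s ≤ r → p s

ForAll1To-init : ∀ {r p} → ForAll1To (suc r) p → ForAll1To r p
ForAll1To-init h s 1≤s s≤r = h s 1≤s (m≤n⇒m≤1+n s≤r)

ForAll1To-last : ∀ {r p} → ForAll1To (suc r) p → p (suc r)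
ForAll1To-last h = h _ (s≤s z≤n) ≤-refl

word-suc : ∀ a i j r →
  word a i j (suc r) ≡ replicate (j (suc r)) (bar a) ++ (replicate (i (suc r)) a ++ word a i j r)
word-suc a i j r = ++-assoc (replicate (j (suc r)) (bar a)) (replicate (i (suc r)) a) (word a i j r)

word-letterIs-a : ∀ a i j r → ForAll1To r (λ s → 1 ≤ j s) → letterIs a (word a i j r) 0 ≡ false
word-letterIs-a a i j zero    _  = eqB-≢ (not-≢ a)
word-letterIs-a a i j (suc r) hj rewrite word-suc a i j r =
  trans (letterIs-replicate a (bar a) _ (ForAll1To-last hj)) (eqB-≢ (not-≢ a))

word-runsBelow-a : ∀ a i j r {P} → 1 ≤ P →
  ForAll1To r (λ s → 1 ≤ j s) → ForAll1To r (λ s → i s < P) → RunsBelow a P (word a i j r)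
word-runsBelow-a a i j zero    P≥1 _  _  = RunsBelow-[] P≥1
word-runsBelow-a a i j (suc r) P≥1 hj hi rewrite word-suc a i j r =
  RunsBelow-replicate-≢ (j (suc r)) P≥1 (not-≢ a)
    (RunsBelow-replicate (i (suc r)) (ForAll1To-last hi) (word-letterIs-a a i j r (ForAll1To-init hj))
      (word-runsBelow-a a i j r P≥1 (ForAll1To-init hj) (ForAll1To-init hi)))

block-runsBelow-bar : ∀ a {P n k l} → 1 ≤ P → n < P → 1 ≤ k → RunsBelow (bar a) P l →
  RunsBelow (bar a) P (replicate n (bar a) ++ (replicate k a ++ l))
block-runsBelow-bar a {n = n} {k} P≥1 n<P k≥1 short =
  RunsBelow-replicate n n<P (trans (letterIs-replicate (bar a) a _ k≥1) (eqB-≢ (not-¬ {a} refl)))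
    (RunsBelow-replicate-≢ k P≥1 (not-¬ refl) short)

word-runsBelow-bar : ∀ a i j r {P} → 1 ≤ P →
  ForAll1To r (λ s → 1 ≤ i s) → ForAll1To r (λ s → j s < P) → RunsBelow (bar a) P (word a i j r)
word-runsBelow-bar a i j zero    P≥1 _  _  = RunsBelow-[] P≥1
word-runsBelow-bar a i j (suc r) P≥1 hi hj rewrite word-suc a i j r =
  block-runsBelow-bar a P≥1 (ForAll1To-last hj) (ForAll1To-last hi)
    (word-runsBelow-bar a i j r P≥1 (ForAll1To-init hi) (ForAll1To-init hj))

-- Dropping the first letter shortens the leading run of bar a, so j_m = P is allowed here.
word-tail-runsBelow-bar : ∀ a i j r {P} → 1 ≤ P → ForAll1To (suc r) (λ s → 1 ≤ i s) →
  1 ≤ j (suc r) → j (suc r) ≤ P → ForAll1To r (λ s → j s < P) →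
  RunsBelow (bar a) P (drop 1 (word a i j (suc r)))
word-tail-runsBelow-bar a i j r {P} P≥1 hi jₘ≥1 jₘ≤P hj rewrite word-suc a i j r =
  tail-block jₘ≥1 jₘ≤P
  where
  tail-block : ∀ {n} → 1 ≤ n → n ≤ P →
    RunsBelow (bar a) P (drop 1 (replicate n (bar a) ++ (replicate (i (suc r)) a ++ word a i j r)))
  tail-block (s≤s z≤n) n≤P = block-runsBelow-bar a P≥1 n≤P (ForAll1To-last hi)
    (word-runsBelow-bar a i j r P≥1 (ForAll1To-init hi) hj)

pow2ceil-isPowerOf2 : ∀ x → IsPowerOf2 (pow2ceil x)
pow2ceil-isPowerOf2 x = ⌈log₂ x ⌉ , refl

⊔-isPowerOf2 : ∀ {x y} → IsPowerOf2 x → IsPowerOf2 y → IsPowerOf2 (x ⊔ y)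
⊔-isPowerOf2 {x} {y} px py with ⊔-sel x y
... | inj₁ x⊔y≡x = subst IsPowerOf2 (sym x⊔y≡x) px
... | inj₂ x⊔y≡y = subst IsPowerOf2 (sym x⊔y≡y) py

⊔-maxOver-isPowerOf2 : ∀ {x} f → IsPowerOf2 x → (∀ s → IsPowerOf2 (f s)) → ∀ r →
  IsPowerOf2 (x ⊔ maxOver f r)
⊔-maxOver-isPowerOf2 {x} f px pf zero    = subst IsPowerOf2 (sym (⊔-identityʳ x)) px
⊔-maxOver-isPowerOf2 {x} f px pf (suc r) =
  subst IsPowerOf2 (⊔-assoc x (f (suc r)) (maxOver f r))
    (⊔-maxOver-isPowerOf2 f (⊔-isPowerOf2 px (pf (suc r))) pf r)

≤-maxOver : ∀ f {r s} → 1 ≤ s → s ≤ r → f s ≤ maxOver f r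
≤-maxOver f {zero}  (s≤s _) ()
≤-maxOver f {suc r} {s} 1≤s s≤1+r with m≤n⇒m<n∨m≡n s≤1+r
... | inj₁ (s≤s s≤r) = ≤-trans (≤-maxOver f 1≤s s≤r) (m≤n⊔m (f (suc r)) (maxOver f r))
... | inj₂ refl      = m≤m⊔n (f (suc r)) (maxOver f r)

≤-2^⌈log2⌉ : ∀ n (rec : Acc _<_ n) → n ≤ 2 ^ ⌈log2⌉ n rec
≤-2^⌈log2⌉ zero          _        = z≤n
≤-2^⌈log2⌉ (suc zero)    _        = ≤-refl
≤-2^⌈log2⌉ (suc (suc n)) (acc rs) = begin
  2 + n                     ≤⟨ +-monoʳ-≤ 2 n≤h+h ⟩
  2 + (h + h)               ≡⟨ cong suc (+-suc h h) ⟨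
  suc h + suc h             ≤⟨ +-mono-≤ ih ih ⟩
  2 ^ L + 2 ^ L             ≡⟨ cong (2 ^ L +_) (+-identityʳ (2 ^ L)) ⟨
  2 ^ suc L                 ∎
  where
  open ≤-Reasoning
  h = ⌈ n /2⌉
  L = ⌈log2⌉ (suc h) (rs (⌈n/2⌉<n n))
  ih : suc h ≤ 2 ^ L
  ih = ≤-2^⌈log2⌉ (suc h) (rs (⌈n/2⌉<n n))
  n≤h+h : n ≤ h + h
  n≤h+h = begin
    n             ≡⟨ ⌊n/2⌋+⌈n/2⌉≡n n ⟨
    ⌊ n /2⌋ + h   ≤⟨ +-monoˡ-≤ h (⌊n/2⌋≤⌈n/2⌉ n) ⟩
    h + h         ∎

≤-pow2ceil : ∀ x → x ≤ pow2ceil x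
≤-pow2ceil x = ≤-2^⌈log2⌉ x (<-wellFounded x)

<-pow2ceil-suc : ∀ x → x < pow2ceil (x + 1)
<-pow2ceil-suc x = subst (_≤ pow2ceil (x + 1)) (+-comm x 1) (≤-pow2ceil (x + 1))

lemma7p5 : (a : Bool) (m : ℕ) (i j : ℕ → ℕ) → 1 ≤ m →
    (∀ r → 1 ≤ r → r ≤ m → 1 ≤ i r) →
    (∀ r → 1 ≤ r → r ≤ m → 1 ≤ j r) →
    ((u : Vec Bool (length (word a i j m))) (n : ℕ) →
       IsCycleLength (S a (fromList (word a i j m))) u n →
       n ≤ maxOver (λ r → pow2ceil (i r + 1)) m)
    ×
    ((u : Vec Bool (length (word a i j m))) (n : ℕ) →
       IsCycleLength (S (bar a) (fromList (word a i j m))) u n →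
       n ≤ pow2ceil (j m) ⊔ maxOver (λ r → pow2ceil (j r + 1)) (m ∸ 1))
lemma7p5 a (suc m) i j _ hi hj =
  S-fromList-cycleLength-≤ a w P₁ P₁-pow2 (RunsBelow-drop1 w (word-runsBelow-a a i j (suc m) P₁≥1 hj i<P₁)) ,
  S-fromList-cycleLength-≤ (bar a) w P₂ P₂-pow2
    (word-tail-runsBelow-bar a i j m P₂≥1 hi (ForAll1To-last hj) jₘ≤P₂ j<P₂)
  where
  w : List Bool
  w = word a i j (suc m)
  f₁ f₂ : ℕ → ℕ
  f₁ r = pow2ceil (i r + 1)
  f₂ r = pow2ceil (j r + 1)
  P₁ P₂ : ℕ
  P₁ = maxOver f₁ (suc m)
  P₂ = pow2ceil (j (suc m)) ⊔ maxOver f₂ m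
  P₁-pow2 : IsPowerOf2 P₁
  P₁-pow2 = ⊔-maxOver-isPowerOf2 f₁ (pow2ceil-isPowerOf2 (i (suc m) + 1)) (λ r → pow2ceil-isPowerOf2 (i r + 1)) m
  P₂-pow2 : IsPowerOf2 P₂
  P₂-pow2 = ⊔-maxOver-isPowerOf2 f₂ (pow2ceil-isPowerOf2 (j (suc m))) (λ r → pow2ceil-isPowerOf2 (j r + 1)) m
  P₁≥1 : 1 ≤ P₁
  P₁≥1 = IsPowerOf2⇒positive P₁-pow2
  P₂≥1 : 1 ≤ P₂
  P₂≥1 = IsPowerOf2⇒positive P₂-pow2
  i<P₁ : ForAll1To (suc m) (λ s → i s < P₁)
  i<P₁ s 1≤s s≤m = <-≤-trans (<-pow2ceil-suc (i s)) (≤-maxOver f₁ 1≤s s≤m)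
  j<P₂ : ForAll1To m (λ s → j s < P₂)
  j<P₂ s 1≤s s≤m = <-≤-trans (<-pow2ceil-suc (j s)) (≤-trans (≤-maxOver f₂ 1≤s s≤m) (m≤n⊔m _ _))
  jₘ≤P₂ : j (suc m) ≤ P₂
  jₘ≤P₂ = ≤-trans (≤-pow2ceil (j (suc m))) (m≤m⊔n _ _)
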